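{- Fix an integer $s\ge1$ and consider the combinatorial Hopf algebra $(\mathcal{A},\zeta_s)$. For every simplicial complex $\Gamma$, $\Psi_{\zeta_s}(\Gamma)=\psi_s(\Gamma;x_1,x_2,\dots)$.
   Context: $\mathcal{A}=\bigoplus_{n\ge0}A_n$ is the Hopf algebra over a field $\mathbb{K}$ where $A_n$ is spanned by isomorphism classes of finite simplicial complexes on $n$ vertices; product is disjoint union, coproduct $\Delta(\Gamma)=\sum_{T\subseteq V(\Gamma)}\Gamma_T\otimes\Gamma_{V(\Gamma)-T}$ where $V(\Gamma)$ is the vertex set and $\Gamma_T=\{X\cap T:X\in\Gamma\}$. The character $\zeta_s:\mathcal{A}\to\mathbb{K}$ is $\zeta_s(\Gamma)=1$ if $\dim\Gamma<s$ and $0$ otherwise (dimension of a face $X$ is $|X|-1$). For a composition $\alpha=(\alpha_1,\dots,\alpha_k)$ of $n$, $M_\alpha=\sum_{i_1<\dots<i_k}x_{i_1}^{\alpha_1}\cdots x_{i_k}^{\alpha_k}$ is the monomial quasi-symmetric function. For $\Gamma\in A_n$, $\Psi_{\zeta_s}(\Gamma)=\sum_{\alpha\vDash n}\zeta_{s,\alpha}(\Gamma)M_\alpha$, where $\zeta_{s,\alpha}$ is the composite $\mathcal{A}\xrightarrow{\Delta^{k-1}}\mathcal{A}^{\otimes k}\to A_{\alpha_1}\otimes\cdots\otimes A_{\alpha_k}\xrightarrow{\zeta_s^{\otimes k}}\mathbb{K}$ (iterated coproduct, then canonical projection). An $s$-simplicial coloring of $\Gamma$ is a map $f:V(\Gamma)\to\mathbb{P}=\{1,2,\dots\}$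 such that every face of $\Gamma$ contains at most $s$ vertices of any given color. The $s$-chromatic symmetric function is $\psi_s(\Gamma;x_1,x_2,\dots)=\sum_f\prod_{i\ge1}x_i^{|f^{ -1}(i)|}$, summed over all $s$-simplicial colorings $f$. -}

module Defs where

open import Level using (Level; _⊔_)
open import Data.Bool using (Bool; true; false; T; if_then_else_; _∧_; _∨_; not)
open import Data.Nat using (ℕ; zero; suc; _≤ᵇ_; _≡ᵇ_)
open import Data.Fin using (Fin; _≟_)
open import Data.Vec using (Vec; []; _∷_; tabulate; lookup; zipWith)
open import Data.List using (List; []; _∷_; _++_; map; concatMap; foldr)
open import Data.Fin.Subset using (Subset; _⊆_; _∩_; _─_; ∣_∣; ⁅_⁆)
  renaming (⊥ to ∅ˢ; ⊤ to fullˢ)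
open import Relation.Nullary using (¬_; does)
open import Data.Product using (∃)
open import Algebra.Bundles using (CommutativeRing)

-- A complex is given by the (decidable) family of its faces, which is
-- closed under taking subsets, contains the empty face and every vertex.
-- (Elements of A_n are isomorphism classes; we work with a representative.)

record SimplicialComplex (n : ℕ) : Set where
  field
    isFace      : Subset n → Bool
    emptyFace   : T (isFace ∅ˢ)
    downClosed  : ∀ {X Y} → Y ⊆ X → T (isFace X) → T (isFace Y)
    vertexFaces : ∀ (i : Fin n) → T (isFace ⁅ i ⁆)
open SimplicialComplex public

allSubsets : (n : ℕ) → List (Subset n)
allSubsets zero    = [] ∷ []
allSubsets (suc n) = map (true ∷_) (allSubsets n) ++ map (false ∷_) (allSubsets n)

allᴸ : ∀ {a} {A : Set a} → (A → Bool) → List A → Bool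
allᴸ p = foldr (λ x b → p x ∧ b) true

_⊆ᵇ_ : ∀ {n} → Subset n → Subset n → Bool
[]      ⊆ᵇ []      = true
(x ∷ p) ⊆ᵇ (y ∷ q) = (not x ∨ y) ∧ (p ⊆ᵇ q)

allFins : (N : ℕ) → List (Fin N)
allFins zero    = []
allFins (suc N) = Fin.zero ∷ map Fin.suc (allFins N)
  where import Data.Fin as Fin

allMaps : (n N : ℕ) → List (Vec (Fin N) n)
allMaps zero    N = [] ∷ []
allMaps (suc n) N = concatMap (λ c → map (c ∷_) (allMaps n N)) (allFins N)

-- compositions of n: lists of positive integers summing to n
-- (each composition of n+1 is obtained uniquely from one of n by either
--  prepending a new part 1 or increasing the first part by 1)
compositions : ℕ → List (List ℕ)
compositions zero    = [] ∷ []
compositions (suc n) = concatMap (λ c → (1 ∷ c) ∷ bump c) (compositions n)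
  where
  bump : List ℕ → List (List ℕ)
  bump []      = []
  bump (a ∷ c) = (suc a ∷ c) ∷ []

IsField : ∀ {c ℓ} → CommutativeRing c ℓ → Set (c ⊔ ℓ)
IsField K = (¬ (1# ≈ 0#)) × (∀ x → ¬ (x ≈ 0#) → ∃ λ y → (x * y) ≈ 1#)
  where open CommutativeRing K
        open import Data.Product using (_×_)

module _ {c ℓ} (K : CommutativeRing c ℓ) where
  open CommutativeRing K

  Σᴸ : ∀ {a} {A : Set a} → List A → (A → Carrier) → Carrier
  Σᴸ xs f = foldr (λ x r → f x + r) 0# xs

  [_]ᴷ : Bool → Carrier
  [ b ]ᴷ = if b then 1# else 0#

  -- ζ_s(Γ_T), where Γ_T = { X ∩ T : X ∈ Γ } :
  -- 1 iff dim Γ_T < s, i.e. every face X ∩ T has |X ∩ T| - 1 < s,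
  -- i.e. |X ∩ T| ≤ s for every face X of Γ.
  zetaRestr : ∀ {n} → ℕ → SimplicialComplex n → Subset n → Carrier
  zetaRestr {n} s Γ T′ =
    [ allᴸ (λ X → not (isFace Γ X) ∨ (∣ X ∩ T′ ∣ ≤ᵇ s)) (allSubsets n) ]ᴷ

  -- ζ_{s,α} applied to the restriction Γ_U  (U ⊆ V(Γ)):
  -- Δ^{k-1} = (id ⊗ Δ^{k-2}) ∘ Δ, with (Γ_U)_T = Γ_T for T ⊆ U;
  -- Δ(Γ_U) = Σ_{T ⊆ U} Γ_T ⊗ Γ_{U-T}; projection onto A_{α_1} keeps |T| = α_1;
  -- Δ^{-1} is the counit (1 on the empty complex, 0 otherwise).
  zetaComp : ∀ {n} → ℕ → SimplicialComplex n → List ℕ → Subset n → Carrier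
  zetaComp s Γ []      U = [ ∣ U ∣ ≡ᵇ 0 ]ᴷ
  zetaComp {n} s Γ (a ∷ α) U =
    Σᴸ (allSubsets n) λ T′ →
      [ (T′ ⊆ᵇ U) ∧ (∣ T′ ∣ ≡ᵇ a) ]ᴷ * (zetaRestr s Γ T′ * zetaComp s Γ α (U ─ T′))

  zetaα : ∀ {n} → ℕ → SimplicialComplex n → List ℕ → Carrier
  zetaα s Γ α = zetaComp s Γ α fullˢ

  -- Coefficient of the monomial x_1^{e_1} ⋯ x_N^{e_N} (all other variables
  -- to the power 0) in M_α = Σ_{i_1 < ⋯ < i_k} x_{i_1}^{α_1} ⋯ x_{i_k}^{α_k}:
  -- split according to whether i_1 is the first remaining variable or not.
  coeffM : List ℕ → ∀ {N} → Vec ℕ N → Carrier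
  coeffM []      []       = 1#
  coeffM []      (e ∷ es) = [ e ≡ᵇ 0 ]ᴷ * coeffM [] es
  coeffM (a ∷ α) []       = 0#
  coeffM (a ∷ α) (e ∷ es) =
    [ e ≡ᵇ a ]ᴷ * coeffM α es + [ e ≡ᵇ 0 ]ᴷ * coeffM (a ∷ α) es

  -- Coefficient of x^e in Ψ_{ζ_s}(Γ) = Σ_{α ⊨ n} ζ_{s,α}(Γ) M_α
  PsiZetaCoeff : ∀ {n} → ℕ → SimplicialComplex n → ∀ {N} → Vec ℕ N → Carrier
  PsiZetaCoeff {n} s Γ e = Σᴸ (compositions n) λ α → zetaα s Γ α * coeffM α e

  -- s-simplicial colourings f : V(Γ) → colours; colour i : Fin N stands for
  -- the positive integer i+1 (variable x_{i+1}).
  countᴸ : ∀ {a} {A : Set a} → (A → Bool) → List A → ℕ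
  countᴸ p = foldr (λ x r → if p x then suc r else r) 0

  colourCount : ∀ {n N} → Vec (Fin N) n → Subset n → Fin N → ℕ
  colourCount f X i = ∣ X ∩ tabulate (λ v → does (lookup f v ≟ i)) ∣

  isSColouring : ∀ {n N} → ℕ → SimplicialComplex n → Vec (Fin N) n → Bool
  isSColouring {n} {N} s Γ f =
    allᴸ (λ X → not (isFace Γ X) ∨ allᴸ (λ i → colourCount f X i ≤ᵇ s) (allFins N))
         (allSubsets n)

  expVec : ∀ {n N} → Vec (Fin N) n → Vec ℕ N
  expVec f = tabulate (colourCount f fullˢ)

  _≡ᵛ_ : ∀ {N} → Vec ℕ N → Vec ℕ N → Bool
  []       ≡ᵛ []       = true
  (x ∷ xs) ≡ᵛ (y ∷ ys) = (x ≡ᵇ y) ∧ (xs ≡ᵛ ys)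

  -- Coefficient of x^e in ψ_s(Γ; x_1, x_2, …) = Σ_f ∏_i x_i^{|f^{-1}(i)|}.
  -- An s-colouring contributes to the monomial x^e (e supported on
  -- x_1..x_N) only if it uses colours 1..N, so we sum over f : V → Fin N.
  psiCoeff : ∀ {n} → ℕ → SimplicialComplex n → ∀ {N} → Vec ℕ N → Carrier
  psiCoeff {n} s Γ {N} e =
    Σᴸ (allMaps n N) λ f → [ isSColouring s Γ f ∧ (expVec f ≡ᵛ e) ]ᴷ

-- Both sides count the same objects. Expanding ζ_{s,α} along the iterated coproduct
-- writes ζ_{s,α}(Γ) as a sum over ordered sequences (T₁, …, T_k) of disjoint vertex
-- sets covering V(Γ) with |Tᵢ| = αᵢ and dim Γ_{Tᵢ} < s; such a sequence is the same as
-- a colouring whose i-th colour class is Tᵢ, and dim Γ_T < s says exactly that every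
-- face meets T in at most s vertices. Reading off the coefficient of a monomial x^e,
-- only the composition α obtained from e by deleting its zero entries contributes,
-- and deleting empty colour classes does not change ζ_{s,α}, since Γ_∅ has dimension
-- −1 < s.
module Submission where

open import Defs
open import Algebra.Bundles using (CommutativeRing)
open import Data.Bool using (Bool; true; false; T; _∧_; _∨_; not)
open import Data.Bool.Properties using (∧-zeroʳ; ∧-identityʳ; ∨-zeroʳ; ∨-distribˡ-∧)
open import Data.Fin using (Fin; zero; suc; _≟_)
open import Data.Fin.Subset using (Subset; _∩_; _─_; ∣_∣) renaming (⊥ to ∅ˢ; ⊤ to fullˢ)
open import Data.Fin.Subset.Properties using (∣⊥∣≡0; ∣⊤∣≡n; p─⊥≡p; ∩-zeroʳ; ∩-identityˡ)
open import Data.List using (List; []; _∷_; _++_; map; concatMap)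
open import Data.List.Properties using (concatMap-cong)
open import Data.Maybe using (Maybe; just; nothing)
import Data.Maybe as Maybe
open import Data.Nat using (ℕ; zero; suc; _≤_; _≡ᵇ_; _≤ᵇ_) renaming (_+_ to _+ℕ_)
import Data.Nat.Properties as ℕ
open import Data.Nat.ListAction using (sum)
open import Data.Product using (_×_; _,_)
open import Data.Unit using (⊤; tt)
open import Data.Vec using (Vec; []; _∷_; tabulate; lookup; toList)
import Data.Vec as Vec
open import Relation.Nullary using (does; contradiction)
open import Relation.Binary.PropositionalEquality
  using (_≡_; _≢_; refl; cong; cong₂; sym; trans; subst)

allᴸ-cong : ∀ {a} {A : Set a} {p q : A → Bool} (xs : List A) →
  (∀ x → p x ≡ q x) → allᴸ p xs ≡ allᴸ q xs
allᴸ-cong []       p≡q = refl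
allᴸ-cong (x ∷ xs) p≡q = cong₂ _∧_ (p≡q x) (allᴸ-cong xs p≡q)

allᴸ-map : ∀ {a b} {A : Set a} {B : Set b} (p : B → Bool) (h : A → B) (xs : List A) →
  allᴸ p (map h xs) ≡ allᴸ (λ x → p (h x)) xs
allᴸ-map p h []       = refl
allᴸ-map p h (x ∷ xs) = cong (p (h x) ∧_) (allᴸ-map p h xs)

allᴸ-true : ∀ {a} {A : Set a} (xs : List A) → allᴸ (λ _ → true) xs ≡ true
allᴸ-true []       = refl
allᴸ-true (x ∷ xs) = allᴸ-true xs

allᴸ-∧ : ∀ {a} {A : Set a} (p q : A → Bool) (xs : List A) →
  allᴸ (λ x → p x ∧ q x) xs ≡ allᴸ p xs ∧ allᴸ q xs
allᴸ-∧ p q [] = refl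
allᴸ-∧ p q (x ∷ xs) with p x | q x
... | false | _     = refl
... | true  | true  = allᴸ-∧ p q xs
... | true  | false = sym (∧-zeroʳ (allᴸ p xs))

allᴸ-comm : ∀ {a b} {A : Set a} {B : Set b} (r : A → B → Bool) (xs : List A) (ys : List B) →
  allᴸ (λ x → allᴸ (r x) ys) xs ≡ allᴸ (λ y → allᴸ (λ x → r x y) xs) ys
allᴸ-comm r []       ys = sym (allᴸ-true ys)
allᴸ-comm r (x ∷ xs) ys =
  trans (cong (allᴸ (r x) ys ∧_) (allᴸ-comm r xs ys))
        (sym (allᴸ-∧ (r x) (λ y → allᴸ (λ x′ → r x′ y) xs) ys))

∨-distribˡ-allᴸ : ∀ {a} {A : Set a} (b : Bool) (p : A → Bool) (ys : List A) →
  b ∨ allᴸ p ys ≡ allᴸ (λ y → b ∨ p y) ys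
∨-distribˡ-allᴸ b p []       = ∨-zeroʳ b
∨-distribˡ-allᴸ b p (y ∷ ys) =
  trans (∨-distribˡ-∧ b (p y) (allᴸ p ys)) (cong ((b ∨ p y) ∧_) (∨-distribˡ-allᴸ b p ys))

∅⊆ᵇ : ∀ {n} (U : Subset n) → ∅ˢ ⊆ᵇ U ≡ true
∅⊆ᵇ []      = refl
∅⊆ᵇ (u ∷ U) = ∅⊆ᵇ U

∣p─q∣+∣q∣≡∣p∣ : ∀ {n} (p q : Subset n) → q ⊆ᵇ p ≡ true → ∣ p ─ q ∣ +ℕ ∣ q ∣ ≡ ∣ p ∣
∣p─q∣+∣q∣≡∣p∣ []           []           _ = refl
∣p─q∣+∣q∣≡∣p∣ (true  ∷ p) (true  ∷ q) q⊆p =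
  trans (ℕ.+-suc ∣ p ─ q ∣ ∣ q ∣) (cong suc (∣p─q∣+∣q∣≡∣p∣ p q q⊆p))
∣p─q∣+∣q∣≡∣p∣ (false ∷ p) (true  ∷ q) ()
∣p─q∣+∣q∣≡∣p∣ (true  ∷ p) (false ∷ q) q⊆p = cong suc (∣p─q∣+∣q∣≡∣p∣ p q q⊆p)
∣p─q∣+∣q∣≡∣p∣ (false ∷ p) (false ∷ q) q⊆p = ∣p─q∣+∣q∣≡∣p∣ p q q⊆p

facesMeetAtMost : ∀ {n} → ℕ → SimplicialComplex n → Subset n → Bool
facesMeetAtMost {n} s Γ T = allᴸ (λ X → not (isFace Γ X) ∨ (∣ X ∩ T ∣ ≤ᵇ s)) (allSubsets n)

facesMeetAtMost-∅ : ∀ {n} s (Γ : SimplicialComplex n) → facesMeetAtMost s Γ ∅ˢ ≡ true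
facesMeetAtMost-∅ {n} s Γ = trans (allᴸ-cong (allSubsets n) meetsEmpty) (allᴸ-true (allSubsets n))
  where
  meetsEmpty : ∀ X → not (isFace Γ X) ∨ (∣ X ∩ ∅ˢ ∣ ≤ᵇ s) ≡ true
  meetsEmpty X rewrite ∩-zeroʳ X | ∣⊥∣≡0 n = ∨-zeroʳ (not (isFace Γ X))

PartialColouring : ℕ → ℕ → Set
PartialColouring n N = Vec (Maybe (Fin N)) n

colourings : ∀ {n} → Subset n → (N : ℕ) → List (PartialColouring n N)
colourings []          N = [] ∷ []
colourings (true  ∷ U) N = concatMap (λ c → map (just c ∷_) (colourings U N)) (allFins N)
colourings (false ∷ U) N = map (nothing ∷_) (colourings U N)

UndefinedOff : ∀ {n N} → Subset n → PartialColouring n N → Set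
UndefinedOff []          []      = ⊤
UndefinedOff (true  ∷ V) (x ∷ g) = UndefinedOff V g
UndefinedOff (false ∷ V) (x ∷ g) = x ≡ nothing × UndefinedOff V g

UndefinedOff-tail : ∀ {n N} u (V : Subset n) (x : Maybe (Fin N)) g →
  UndefinedOff (u ∷ V) (x ∷ g) → UndefinedOff V g
UndefinedOff-tail true  V x g off       = off
UndefinedOff-tail false V x g (_ , off) = off

hasColour : ∀ {N} → Maybe (Fin N) → Fin N → Bool
hasColour nothing  i = false
hasColour (just c) i = does (c ≟ i)

colourClass : ∀ {n N} → PartialColouring n N → Fin N → Subset n
colourClass []      i = []
colourClass (x ∷ f) i = hasColour x i ∷ colourClass f i

colourClass-just : ∀ {n N} (f : Vec (Fin N) n) i →
  colourClass (Vec.map just f) i ≡ tabulate (λ v → does (lookup f v ≟ i))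
colourClass-just []      i = refl
colourClass-just (x ∷ f) i = cong (does (x ≟ i) ∷_) (colourClass-just f i)

consColour : ∀ {n N} → Subset n → PartialColouring n N → PartialColouring n (suc N)
consColour []          []      = []
consColour (true  ∷ T) (x ∷ g) = just zero ∷ consColour T g
consColour (false ∷ T) (x ∷ g) = Maybe.map suc x ∷ consColour T g

colourClass-consColour-zero : ∀ {n N} (T : Subset n) (g : PartialColouring n N) →
  colourClass (consColour T g) zero ≡ T
colourClass-consColour-zero []          []            = refl
colourClass-consColour-zero (true  ∷ T) (x ∷ g)       = cong (true ∷_) (colourClass-consColour-zero T g)
colourClass-consColour-zero (false ∷ T) (nothing ∷ g) = cong (false ∷_) (colourClass-consColour-zero T g)
colourClass-consColour-zero (false ∷ T) (just c ∷ g)  = cong (false ∷_) (colourClass-consColour-zero T g)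

hasColour-suc : ∀ {N} (x : Maybe (Fin N)) i → hasColour (Maybe.map suc x) (suc i) ≡ hasColour x i
hasColour-suc nothing  i = refl
hasColour-suc (just c) i = refl

colourClass-consColour-suc : ∀ {n N} (U T : Subset n) (g : PartialColouring n N) (i : Fin N) →
  UndefinedOff (U ─ T) g → colourClass (consColour T g) (suc i) ≡ colourClass g i
colourClass-consColour-suc []      []          []             i _ = refl
colourClass-consColour-suc (u ∷ U) (true  ∷ T) (.nothing ∷ g) i (refl , off) =
  cong (false ∷_) (colourClass-consColour-suc U T g i off)
colourClass-consColour-suc (u ∷ U) (false ∷ T) (x ∷ g)        i off =
  cong₂ _∷_ (hasColour-suc x i)
    (colourClass-consColour-suc U T g i (UndefinedOff-tail u (U ─ T) x g off))

dropZeros : ∀ {N} → Vec ℕ N → List ℕ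
dropZeros []           = []
dropZeros (zero  ∷ es) = dropZeros es
dropZeros (suc x ∷ es) = suc x ∷ dropZeros es

allPositive : List ℕ → Bool
allPositive []          = true
allPositive (zero  ∷ _) = false
allPositive (suc _ ∷ α) = allPositive α

allPositive-dropZeros : ∀ {N} (e : Vec ℕ N) → allPositive (dropZeros e) ≡ true
allPositive-dropZeros []           = refl
allPositive-dropZeros (zero  ∷ es) = allPositive-dropZeros es
allPositive-dropZeros (suc x ∷ es) = allPositive-dropZeros es

-- Compares b ≡ᵇ a rather than a ≡ᵇ b so that it agrees with coeffM definitionally.
_==ᴸ_ : List ℕ → List ℕ → Bool
[]      ==ᴸ []      = true
[]      ==ᴸ (_ ∷ _) = false
(_ ∷ _) ==ᴸ []      = false
(a ∷ α) ==ᴸ (b ∷ β) = (b ≡ᵇ a) ∧ (α ==ᴸ β)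

growComposition : List ℕ → List (List ℕ)
growComposition []      = (1 ∷ []) ∷ []
growComposition (a ∷ c) = (1 ∷ a ∷ c) ∷ (suc a ∷ c) ∷ []

compositions-suc : ∀ n → compositions (suc n) ≡ concatMap growComposition (compositions n)
compositions-suc n = concatMap-cong (λ { [] → refl ; (a ∷ c) → refl }) (compositions n)

module _ {c ℓ} (K : CommutativeRing c ℓ) where
  open CommutativeRing K
    renaming (refl to ≈-refl; sym to ≈-sym; trans to ≈-trans; reflexive to ≈-reflexive; zero to *-zero)
  open import Algebra.Properties.CommutativeSemigroup +-commutativeSemigroup using (interchange)
  open import Relation.Binary.Reasoning.Setoid setoid

  private
    ∑ : ∀ {a} {A : Set a} → List A → (A → Carrier) → Carrier
    ∑ = Σᴸ K

    [_] : Bool → Carrier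
    [_] = [_]ᴷ K

  ∑-cong : ∀ {a} {A : Set a} (xs : List A) {f g : A → Carrier} →
    (∀ x → f x ≈ g x) → ∑ xs f ≈ ∑ xs g
  ∑-cong []       f≈g = ≈-refl
  ∑-cong (x ∷ xs) f≈g = +-cong (f≈g x) (∑-cong xs f≈g)

  ∑-++ : ∀ {a} {A : Set a} (xs ys : List A) {f : A → Carrier} → ∑ (xs ++ ys) f ≈ ∑ xs f + ∑ ys f
  ∑-++ []       ys = ≈-sym (+-identityˡ _)
  ∑-++ (x ∷ xs) ys = ≈-trans (+-congˡ (∑-++ xs ys)) (≈-sym (+-assoc _ _ _))

  ∑-map : ∀ {a b} {A : Set a} {B : Set b} (h : A → B) (xs : List A) {f : B → Carrier} →
    ∑ (map h xs) f ≈ ∑ xs (λ x → f (h x))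
  ∑-map h []       = ≈-refl
  ∑-map h (x ∷ xs) = +-congˡ (∑-map h xs)

  ∑-concatMap : ∀ {a b} {A : Set a} {B : Set b} (xs : List A) {h : A → List B} {f : B → Carrier} →
    ∑ (concatMap h xs) f ≈ ∑ xs (λ x → ∑ (h x) f)
  ∑-concatMap []           = ≈-refl
  ∑-concatMap (x ∷ xs) {h} = ≈-trans (∑-++ (h x) _) (+-congˡ (∑-concatMap xs))

  ∑-zero : ∀ {a} {A : Set a} (xs : List A) {f : A → Carrier} → (∀ x → f x ≈ 0#) → ∑ xs f ≈ 0#
  ∑-zero []       f≈0 = ≈-refl
  ∑-zero (x ∷ xs) f≈0 = ≈-trans (+-cong (f≈0 x) (∑-zero xs f≈0)) (+-identityˡ 0#)

  ∑-*ˡ : ∀ {a} {A : Set a} (xs : List A) (k : Carrier) {f : A → Carrier} →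
    ∑ xs (λ x → k * f x) ≈ k * ∑ xs f
  ∑-*ˡ []       k = ≈-sym (zeroʳ k)
  ∑-*ˡ (x ∷ xs) k = ≈-trans (+-congˡ (∑-*ˡ xs k)) (≈-sym (distribˡ k _ _))

  ∑-+ : ∀ {a} {A : Set a} (xs : List A) {f g : A → Carrier} →
    ∑ xs (λ x → f x + g x) ≈ ∑ xs f + ∑ xs g
  ∑-+ []       = ≈-sym (+-identityˡ 0#)
  ∑-+ (x ∷ xs) = ≈-trans (+-congˡ (∑-+ xs)) (interchange _ _ _ _)

  ∑-comm : ∀ {a b} {A : Set a} {B : Set b} (xs : List A) (ys : List B) {F : A → B → Carrier} →
    ∑ xs (λ x → ∑ ys (F x)) ≈ ∑ ys (λ y → ∑ xs (λ x → F x y))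
  ∑-comm []       ys = ≈-sym (∑-zero ys (λ _ → ≈-refl))
  ∑-comm (x ∷ xs) ys = ≈-trans (+-congˡ (∑-comm xs ys)) (≈-sym (∑-+ ys))

  [∧] : ∀ a b → [ a ∧ b ] ≈ [ a ] * [ b ]
  [∧] true  b = ≈-sym (*-identityˡ _)
  [∧] false b = ≈-sym (zeroˡ _)

  ∑-allSubsets-suc : ∀ {n} (F : Subset (suc n) → Carrier) →
    ∑ (allSubsets (suc n)) F ≈ ∑ (allSubsets n) (λ T → F (true ∷ T)) + ∑ (allSubsets n) (λ T → F (false ∷ T))
  ∑-allSubsets-suc {n} F =
    ≈-trans (∑-++ (map (true ∷_) (allSubsets n)) _)
            (+-cong (∑-map (true ∷_) (allSubsets n)) (∑-map (false ∷_) (allSubsets n)))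

  ∑-allSubsets-empty : ∀ {n} (b : Subset n → Bool) (H : Subset n → Carrier) →
    ∑ (allSubsets n) (λ T → [ b T ∧ (∣ T ∣ ≡ᵇ 0) ] * H T) ≈ [ b ∅ˢ ] * H ∅ˢ
  ∑-allSubsets-empty {zero} b H =
    ≈-trans (+-identityʳ _) (*-congʳ (≈-reflexive (cong [_] (∧-identityʳ (b [])))))
  ∑-allSubsets-empty {suc n} b H =
    begin
      ∑ (allSubsets (suc n)) (λ T → [ b T ∧ (∣ T ∣ ≡ᵇ 0) ] * H T)
    ≈⟨ ∑-allSubsets-suc {n} _ ⟩
      ∑ (allSubsets n) (λ T → [ b (true ∷ T) ∧ false ] * H (true ∷ T)) + _
    ≈⟨ +-congʳ (∑-zero (allSubsets n) λ T →
         ≈-trans (*-congʳ (≈-reflexive (cong [_] (∧-zeroʳ (b (true ∷ T)))))) (zeroˡ _)) ⟩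
      0# + _
    ≈⟨ +-identityˡ _ ⟩
      ∑ (allSubsets n) (λ T → [ b (false ∷ T) ∧ (∣ T ∣ ≡ᵇ 0) ] * H (false ∷ T))
    ≈⟨ ∑-allSubsets-empty (λ T → b (false ∷ T)) (λ T → H (false ∷ T)) ⟩
      [ b ∅ˢ ] * H ∅ˢ
    ∎

  ∑-colourings-true : ∀ {n N} (U : Subset n) (h : PartialColouring (suc n) N → Carrier) →
    ∑ (colourings (true ∷ U) N) h ≈ ∑ (allFins N) (λ c → ∑ (colourings U N) (λ g → h (just c ∷ g)))
  ∑-colourings-true {N = N} U h =
    ≈-trans (∑-concatMap (allFins N)) (∑-cong (allFins N) (λ c → ∑-map (just c ∷_) (colourings U N)))

  ∑-colourings-cong : ∀ {n N} (V : Subset n) {h h′ : PartialColouring n N → Carrier} →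
    (∀ g → UndefinedOff V g → h g ≈ h′ g) → ∑ (colourings V N) h ≈ ∑ (colourings V N) h′
  ∑-colourings-cong [] h≈h′ = +-cong (h≈h′ [] tt) ≈-refl
  ∑-colourings-cong {N = N} (true ∷ V) {h} {h′} h≈h′ =
    ≈-trans (∑-colourings-true V h)
      (≈-trans (∑-cong (allFins N) (λ c → ∑-colourings-cong V (λ g → h≈h′ (just c ∷ g))))
               (≈-sym (∑-colourings-true V h′)))
  ∑-colourings-cong {N = N} (false ∷ V) h≈h′ =
    ≈-trans (∑-map (nothing ∷_) (colourings V N))
      (≈-trans (∑-colourings-cong V (λ g off → h≈h′ (nothing ∷ g) (refl , off)))
               (≈-sym (∑-map (nothing ∷_) (colourings V N))))

  ∑-colourings-zero : ∀ {n} (U : Subset n) → ∑ (colourings U 0) (λ _ → 1#) ≈ [ ∣ U ∣ ≡ᵇ 0 ]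
  ∑-colourings-zero []          = +-identityʳ _
  ∑-colourings-zero (true  ∷ U) = ≈-refl
  ∑-colourings-zero (false ∷ U) = ≈-trans (∑-map (nothing ∷_) (colourings U 0)) (∑-colourings-zero U)

  -- A colouring of U with colours 0, …, N is its class T of colour 0 together with
  -- a colouring of U ─ T with colours 1, …, N.
  ∑-colourings-suc : ∀ {n N} (U : Subset n) (h : PartialColouring n (suc N) → Carrier) →
    ∑ (colourings U (suc N)) h ≈
    ∑ (allSubsets n) (λ T → [ T ⊆ᵇ U ] * ∑ (colourings (U ─ T) N) (λ g → h (consColour T g)))
  ∑-colourings-suc [] h = ≈-trans (≈-sym (*-identityˡ _)) (≈-sym (+-identityʳ _))
  ∑-colourings-suc {suc n} {N} (true ∷ U) h =
    begin
      ∑ (colourings (true ∷ U) (suc N)) h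
    ≈⟨ ∑-colourings-true U h ⟩
      ∑ (colourings U (suc N)) (λ g → h (just zero ∷ g))
        + ∑ (map suc (allFins N)) (λ c → ∑ (colourings U (suc N)) (λ g → h (just c ∷ g)))
    ≈⟨ +-cong (∑-colourings-suc U _)
              (≈-trans (∑-map suc (allFins N)) (∑-cong (allFins N) (λ c → ∑-colourings-suc U _))) ⟩
      ∑ S (λ T → [ T ⊆ᵇ U ] * ∑ (colourings (U ─ T) N) (λ g → h (just zero ∷ consColour T g)))
        + ∑ (allFins N) (λ c → ∑ S (λ T → [ T ⊆ᵇ U ] * shifted c T))
    ≈⟨ +-congˡ (≈-trans (∑-comm (allFins N) S) (∑-cong S (λ T → ∑-*ˡ (allFins N) _))) ⟩
      ∑ S (λ T → [ T ⊆ᵇ U ] * ∑ (colourings (U ─ T) N) (λ g → h (just zero ∷ consColour T g)))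
        + ∑ S (λ T → [ T ⊆ᵇ U ] * ∑ (allFins N) (λ c → shifted c T))
    ≈⟨ +-cong (∑-cong S (λ T → *-congˡ (∑-map (nothing ∷_) (colourings (U ─ T) N))))
              (∑-cong S (λ T → *-congˡ (∑-colourings-true {N = N} (U ─ T) _))) ⟨
      ∑ S (λ T → F (true ∷ T)) + ∑ S (λ T → F (false ∷ T))
    ≈⟨ ∑-allSubsets-suc F ⟨
      ∑ (allSubsets (suc n)) F
    ∎
    where
    S = allSubsets n
    shifted : Fin N → Subset n → Carrier
    shifted c T = ∑ (colourings (U ─ T) N) (λ g → h (just (suc c) ∷ consColour T g))
    F : Subset (suc n) → Carrier
    F T = [ T ⊆ᵇ (true ∷ U) ] * ∑ (colourings ((true ∷ U) ─ T) N) (λ g → h (consColour T g))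
  ∑-colourings-suc {suc n} {N} (false ∷ U) h =
    begin
      ∑ (colourings (false ∷ U) (suc N)) h
    ≈⟨ ∑-map (nothing ∷_) (colourings U (suc N)) ⟩
      ∑ (colourings U (suc N)) (λ g → h (nothing ∷ g))
    ≈⟨ ∑-colourings-suc U _ ⟩
      ∑ S (λ T → [ T ⊆ᵇ U ] * ∑ (colourings (U ─ T) N) (λ g → h (nothing ∷ consColour T g)))
    ≈⟨ +-identityˡ _ ⟨
      0# + ∑ S (λ T → [ T ⊆ᵇ U ] * ∑ (colourings (U ─ T) N) (λ g → h (nothing ∷ consColour T g)))
    ≈⟨ +-cong (∑-zero S (λ T → zeroˡ _))
              (∑-cong S (λ T → *-congˡ (∑-map (nothing ∷_) (colourings (U ─ T) N)))) ⟨
      ∑ S (λ T → F (true ∷ T)) + ∑ S (λ T → F (false ∷ T))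
    ≈⟨ ∑-allSubsets-suc F ⟨
      ∑ (allSubsets (suc n)) F
    ∎
    where
    S = allSubsets n
    F : Subset (suc n) → Carrier
    F T = [ T ⊆ᵇ (false ∷ U) ] * ∑ (colourings ((false ∷ U) ─ T) N) (λ g → h (consColour T g))

  ∑-colourings-full : ∀ {n N} (h : PartialColouring n N → Carrier) →
    ∑ (colourings (fullˢ {n}) N) h ≈ ∑ (allMaps n N) (λ f → h (Vec.map just f))
  ∑-colourings-full {zero}      h = ≈-refl
  ∑-colourings-full {suc n} {N} h =
    ≈-trans (∑-colourings-true fullˢ h)
      (≈-trans (∑-cong (allFins N) (λ c → ∑-colourings-full (λ g → h (just c ∷ g))))
        (≈-sym (≈-trans (∑-concatMap (allFins N))
                        (∑-cong (allFins N) (λ c → ∑-map (c ∷_) (allMaps n N))))))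

  coeffM-allPositive : ∀ α {N} (e : Vec ℕ N) → T (allPositive α) →
    coeffM K α e ≈ [ α ==ᴸ dropZeros e ]
  coeffM-allPositive []          []           _ = ≈-refl
  coeffM-allPositive (a ∷ α)     []           _ = ≈-refl
  coeffM-allPositive []          (zero ∷ es)  p = ≈-trans (*-identityˡ _) (coeffM-allPositive [] es p)
  coeffM-allPositive []          (suc x ∷ es) _ = zeroˡ _
  coeffM-allPositive (suc a ∷ α) (zero ∷ es)  p =
    ≈-trans (+-cong (zeroˡ _) (*-identityˡ _))
            (≈-trans (+-identityˡ _) (coeffM-allPositive (suc a ∷ α) es p))
  coeffM-allPositive (suc a ∷ α) (suc x ∷ es) p =
    ≈-trans (+-cong (*-congˡ (coeffM-allPositive α es p)) (zeroˡ _))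
            (≈-trans (+-identityʳ _) (≈-sym ([∧] (x ≡ᵇ a) _)))

  ∑-compositions-suc : ∀ n (H : List ℕ → Carrier) →
    ∑ (compositions (suc n)) H ≈ ∑ (compositions n) (λ c → ∑ (growComposition c) H)
  ∑-compositions-suc n H =
    ≈-trans (≈-reflexive (cong (λ cs → ∑ cs H) (compositions-suc n))) (∑-concatMap (compositions n))

  ∑-compositions-cong : ∀ n {H H′ : List ℕ → Carrier} →
    (∀ α → T (allPositive α) → H α ≈ H′ α) → ∑ (compositions n) H ≈ ∑ (compositions n) H′
  ∑-compositions-cong zero    H≈H′ = +-cong (H≈H′ [] tt) ≈-refl
  ∑-compositions-cong (suc n) {H} {H′} H≈H′ =
    ≈-trans (∑-compositions-suc n H)
      (≈-trans (∑-compositions-cong n grown) (≈-sym (∑-compositions-suc n H′)))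
    where
    grown : ∀ c → T (allPositive c) → ∑ (growComposition c) H ≈ ∑ (growComposition c) H′
    grown []          _ = +-cong (H≈H′ (1 ∷ []) tt) ≈-refl
    grown (suc a ∷ c) p = +-cong (H≈H′ (1 ∷ suc a ∷ c) p) (+-cong (H≈H′ (suc (suc a) ∷ c) p) ≈-refl)

  ∑-growComposition-zero : (F : List ℕ → Carrier) → (∀ a α → F (suc a ∷ α) ≈ 0#) →
    ∀ c → ∑ (growComposition c) F ≈ 0#
  ∑-growComposition-zero F F≈0 []      = ≈-trans (+-identityʳ _) (F≈0 0 [])
  ∑-growComposition-zero F F≈0 (a ∷ c) =
    ≈-trans (+-cong (F≈0 0 (a ∷ c)) (≈-trans (+-identityʳ _) (F≈0 a c))) (+-identityʳ _)

  ∑-compositions-select : ∀ n (g : List ℕ → Carrier) β →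
    ∑ (compositions n) (λ α → g α * [ α ==ᴸ β ]) ≈ [ allPositive β ∧ (sum β ≡ᵇ n) ] * g β
  ∑-compositions-select zero g [] = ≈-trans (+-identityʳ _) (≈-trans (*-identityʳ _) (≈-sym (*-identityˡ _)))
  ∑-compositions-select zero g (zero ∷ β) = ≈-trans (+-identityʳ _) (≈-trans (zeroʳ _) (≈-sym (zeroˡ _)))
  ∑-compositions-select zero g (suc b ∷ β) =
    ≈-trans (+-identityʳ _) (≈-trans (zeroʳ _)
      (≈-sym (≈-trans (*-congʳ (≈-reflexive (cong [_] (∧-zeroʳ (allPositive β))))) (zeroˡ _))))
  ∑-compositions-select (suc n) g [] =
    ≈-trans (∑-compositions-suc n _)
      (≈-trans (∑-zero (compositions n) (∑-growComposition-zero _ (λ _ _ → zeroʳ _))) (≈-sym (zeroˡ _)))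
  ∑-compositions-select (suc n) g (zero ∷ β) =
    ≈-trans (∑-compositions-suc n _)
      (≈-trans (∑-zero (compositions n) (∑-growComposition-zero _ (λ _ _ → zeroʳ _))) (≈-sym (zeroˡ _)))
  ∑-compositions-select (suc n) g (suc b ∷ β) =
    begin
      ∑ (compositions (suc n)) (λ α → g α * [ α ==ᴸ (suc b ∷ β) ])
    ≈⟨ ∑-compositions-suc n _ ⟩
      ∑ (compositions n) (λ c → ∑ (growComposition c) (λ α → g α * [ α ==ᴸ (suc b ∷ β) ]))
    ≈⟨ ∑-cong (compositions n) byGrowth ⟩
      ∑ (compositions n) (λ c → g (1 ∷ c) * [ (b ≡ᵇ 0) ∧ (c ==ᴸ β) ] + g⁺ c * [ c ==ᴸ (b ∷ β) ])
    ≈⟨ ∑-+ (compositions n) ⟩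
      ∑ (compositions n) (λ c → g (1 ∷ c) * [ (b ≡ᵇ 0) ∧ (c ==ᴸ β) ])
        + ∑ (compositions n) (λ c → g⁺ c * [ c ==ᴸ (b ∷ β) ])
    ≈⟨ byFirstPart b ⟩
      [ allPositive (suc b ∷ β) ∧ (sum (suc b ∷ β) ≡ᵇ suc n) ] * g (suc b ∷ β)
    ∎
    where
    g⁺ : List ℕ → Carrier
    g⁺ []      = 0#
    g⁺ (a ∷ c) = g (suc a ∷ c)

    byGrowth : ∀ c → ∑ (growComposition c) (λ α → g α * [ α ==ᴸ (suc b ∷ β) ]) ≈
      g (1 ∷ c) * [ (b ≡ᵇ 0) ∧ (c ==ᴸ β) ] + g⁺ c * [ c ==ᴸ (b ∷ β) ]
    byGrowth []      = +-congˡ (≈-sym (zeroˡ _))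
    byGrowth (a ∷ c) = +-congˡ (+-identityʳ _)

    byFirstPart : ∀ b →
      ∑ (compositions n) (λ c → g (1 ∷ c) * [ (b ≡ᵇ 0) ∧ (c ==ᴸ β) ])
        + ∑ (compositions n) (λ c → g⁺ c * [ c ==ᴸ (b ∷ β) ])
      ≈ [ allPositive (suc b ∷ β) ∧ (sum (suc b ∷ β) ≡ᵇ suc n) ] * g (suc b ∷ β)
    byFirstPart zero =
      ≈-trans (+-cong (∑-compositions-select n (λ c → g (1 ∷ c)) β)
                      (≈-trans (∑-compositions-select n g⁺ (zero ∷ β)) (zeroˡ _)))
              (+-identityʳ _)
    byFirstPart (suc b′) =
      ≈-trans (+-cong (∑-zero (compositions n) (λ c → zeroʳ _))
                      (∑-compositions-select n g⁺ (suc b′ ∷ β)))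
              (+-identityˡ _)

  module _ (s : ℕ) {n} (Γ : SimplicialComplex n) where
    private
      ζ : List ℕ → Subset n → Carrier
      ζ = zetaComp K s Γ

    zetaComp-zero∷ : ∀ α U → ζ (0 ∷ α) U ≈ ζ α U
    zetaComp-zero∷ α U =
      begin
        ζ (0 ∷ α) U
      ≈⟨ ∑-allSubsets-empty (λ T → T ⊆ᵇ U) (λ T → zetaRestr K s Γ T * ζ α (U ─ T)) ⟩
        [ ∅ˢ ⊆ᵇ U ] * ([ facesMeetAtMost s Γ ∅ˢ ] * ζ α (U ─ ∅ˢ))
      ≡⟨ cong₂ (λ a b → [ a ] * ([ b ] * ζ α (U ─ ∅ˢ))) (∅⊆ᵇ U) (facesMeetAtMost-∅ s Γ) ⟩
        1# * (1# * ζ α (U ─ ∅ˢ))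
      ≈⟨ ≈-trans (*-identityˡ _) (*-identityˡ _) ⟩
        ζ α (U ─ ∅ˢ)
      ≡⟨ cong (ζ α) (p─⊥≡p U) ⟩
        ζ α U
      ∎

    zetaComp-dropZeros : ∀ {N} (e : Vec ℕ N) U → ζ (dropZeros e) U ≈ ζ (toList e) U
    zetaComp-dropZeros []           U = ≈-refl
    zetaComp-dropZeros (zero  ∷ es) U = ≈-trans (zetaComp-dropZeros es U) (≈-sym (zetaComp-zero∷ (toList es) U))
    zetaComp-dropZeros (suc x ∷ es) U =
      ∑-cong (allSubsets n) λ T → *-congˡ (*-congˡ (zetaComp-dropZeros es (U ─ T)))

    zetaComp-sum≢size : ∀ α (U : Subset n) → sum α ≢ ∣ U ∣ → ζ α U ≈ 0#
    zetaComp-sum≢size [] U sum≢ with ∣ U ∣ | sum≢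
    ... | zero  | 0≢0 = contradiction refl 0≢0
    ... | suc _ | _   = ≈-refl
    zetaComp-sum≢size (a ∷ α) U sum≢ = ∑-zero (allSubsets n) term
      where
      term : ∀ W → [ (W ⊆ᵇ U) ∧ (∣ W ∣ ≡ᵇ a) ] * (zetaRestr K s Γ W * ζ α (U ─ W)) ≈ 0#
      term W with W ⊆ᵇ U in W⊆ᵇU | ∣ W ∣ ≡ᵇ a in ∣W∣≡ᵇa
      ... | false | _     = zeroˡ _
      ... | true  | false = zeroˡ _
      ... | true  | true  =
        ≈-trans (*-congˡ (≈-trans (*-congˡ (zetaComp-sum≢size α (U ─ W) rest≢)) (zeroʳ _))) (zeroʳ _)
        where
        rest≢ : sum α ≢ ∣ U ─ W ∣
        rest≢ eq = sum≢ (trans (cong₂ _+ℕ_ a≡∣W∣ eq)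
                        (trans (ℕ.+-comm ∣ W ∣ ∣ U ─ W ∣) (∣p─q∣+∣q∣≡∣p∣ U W W⊆ᵇU)))
          where
          a≡∣W∣ : a ≡ ∣ W ∣
          a≡∣W∣ = sym (ℕ.≡ᵇ⇒≡ ∣ W ∣ a (subst T (sym ∣W∣≡ᵇa) tt))

    zetaComp-sum≡size : ∀ α (U : Subset n) → [ sum α ≡ᵇ ∣ U ∣ ] * ζ α U ≈ ζ α U
    zetaComp-sum≡size α U with sum α ≡ᵇ ∣ U ∣ in sum≡
    ... | true  = *-identityˡ _
    ... | false = ≈-trans (zeroˡ _) (≈-sym (zetaComp-sum≢size α U
                    (λ eq → subst T sum≡ (ℕ.≡⇒≡ᵇ (sum α) ∣ U ∣ eq))))

    PsiZetaCoeff≈zetaComp : ∀ {N} (e : Vec ℕ N) → PsiZetaCoeff K s Γ e ≈ ζ (toList e) fullˢ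
    PsiZetaCoeff≈zetaComp e =
      begin
        ∑ (compositions n) (λ α → ζ α fullˢ * coeffM K α e)
      ≈⟨ ∑-compositions-cong n (λ α pos → *-congˡ (coeffM-allPositive α e pos)) ⟩
        ∑ (compositions n) (λ α → ζ α fullˢ * [ α ==ᴸ dropZeros e ])
      ≈⟨ ∑-compositions-select n (λ α → ζ α fullˢ) (dropZeros e) ⟩
        [ allPositive (dropZeros e) ∧ (sum (dropZeros e) ≡ᵇ n) ] * ζ (dropZeros e) fullˢ
      ≡⟨ cong (λ b → [ b ] * ζ (dropZeros e) fullˢ)
              (cong₂ (λ p m → p ∧ (sum (dropZeros e) ≡ᵇ m)) (allPositive-dropZeros e) (sym (∣⊤∣≡n n))) ⟩
        [ sum (dropZeros e) ≡ᵇ ∣ fullˢ {n} ∣ ] * ζ (dropZeros e) fullˢ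
      ≈⟨ zetaComp-sum≡size (dropZeros e) fullˢ ⟩
        ζ (dropZeros e) fullˢ
      ≈⟨ zetaComp-dropZeros e fullˢ ⟩
        ζ (toList e) fullˢ
      ∎

    fits : Subset n → ℕ → Bool
    fits T a = facesMeetAtMost s Γ T ∧ (∣ T ∣ ≡ᵇ a)

    zetaComp≈∑-colourings : ∀ {N} (e : Vec ℕ N) U →
      ζ (toList e) U ≈
      ∑ (colourings U N) (λ f → [ allᴸ (λ i → fits (colourClass f i) (lookup e i)) (allFins N) ])
    zetaComp≈∑-colourings [] U = ≈-sym (∑-colourings-zero U)
    zetaComp≈∑-colourings {suc N} (a ∷ e) U = ≈-sym (
      begin
        ∑ (colourings U (suc N)) (λ f → [ allᴸ (λ i → fits (colourClass f i) (lookup (a ∷ e) i)) (allFins (suc N)) ])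
      ≈⟨ ∑-colourings-suc U _ ⟩
        ∑ S (λ T → [ T ⊆ᵇ U ] * ∑ (colourings (U ─ T) N) (λ g →
          [ allᴸ (λ i → fits (colourClass (consColour T g) i) (lookup (a ∷ e) i)) (allFins (suc N)) ]))
      ≈⟨ ∑-cong S (λ T → *-congˡ (∑-colourings-cong (U ─ T) (λ g off → ≈-reflexive (cong [_] (classes T g off))))) ⟩
        ∑ S (λ T → [ T ⊆ᵇ U ] * ∑ (colourings (U ─ T) N) (λ g → [ fits T a ∧ rest g ]))
      ≈⟨ ∑-cong S (λ T → *-congˡ (≈-trans (∑-cong (colourings (U ─ T) N) (λ g → [∧] (fits T a) (rest g)))
                                             (∑-*ˡ (colourings (U ─ T) N) [ fits T a ]))) ⟩
        ∑ S (λ T → [ T ⊆ᵇ U ] * ([ fits T a ] * ∑ (colourings (U ─ T) N) (λ g → [ rest g ])))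
      ≈⟨ ∑-cong S (λ T → *-congˡ (*-congˡ (zetaComp≈∑-colourings e (U ─ T)))) ⟨
        ∑ S (λ T → [ T ⊆ᵇ U ] * ([ fits T a ] * ζ (toList e) (U ─ T)))
      ≈⟨ ∑-cong S (λ T → moveSizeTest (T ⊆ᵇ U) (facesMeetAtMost s Γ T) (∣ T ∣ ≡ᵇ a) _) ⟩
        ζ (a ∷ toList e) U
      ∎)
      where
      S = allSubsets n

      rest : PartialColouring n N → Bool
      rest g = allᴸ (λ i → fits (colourClass g i) (lookup e i)) (allFins N)

      classes : ∀ T g → UndefinedOff (U ─ T) g →
        allᴸ (λ i → fits (colourClass (consColour T g) i) (lookup (a ∷ e) i)) (allFins (suc N))
        ≡ fits T a ∧ rest g
      classes T g off =
        cong₂ _∧_ (cong (λ X → fits X a) (colourClass-consColour-zero T g))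
          (trans (allᴸ-map (λ i → fits (colourClass (consColour T g) i) (lookup (a ∷ e) i)) suc (allFins N))
                 (allᴸ-cong (allFins N)
                   (λ i → cong (λ X → fits X (lookup e i)) (colourClass-consColour-suc U T g i off))))

      moveSizeTest : ∀ t m z W → [ t ] * ([ m ∧ z ] * W) ≈ [ t ∧ z ] * ([ m ] * W)
      moveSizeTest false m     z     W = ≈-trans (zeroˡ _) (≈-sym (zeroˡ _))
      moveSizeTest true  true  true  W = ≈-refl
      moveSizeTest true  false true  W = ≈-refl
      moveSizeTest true  true  false W = ≈-trans (*-identityˡ _) (≈-trans (zeroˡ _) (≈-sym (zeroˡ _)))
      moveSizeTest true  false false W = ≈-trans (*-identityˡ _) (≈-trans (zeroˡ _) (≈-sym (zeroˡ _)))

    tabulate-≡ᵛ : ∀ {N} (g : Fin N → ℕ) (e : Vec ℕ N) →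
      _≡ᵛ_ K (tabulate g) e ≡ allᴸ (λ i → g i ≡ᵇ lookup e i) (allFins N)
    tabulate-≡ᵛ {zero}  g []       = refl
    tabulate-≡ᵛ {suc N} g (x ∷ es) = cong ((g zero ≡ᵇ x) ∧_)
      (trans (tabulate-≡ᵛ (λ i → g (suc i)) es)
             (sym (allᴸ-map (λ i → g i ≡ᵇ lookup (x ∷ es) i) suc (allFins N))))

    allClassesFit≡isSColouring∧expVec : ∀ {N} (e : Vec ℕ N) (f : Vec (Fin N) n) →
      allᴸ (λ i → fits (colourClass (Vec.map just f) i) (lookup e i)) (allFins N)
      ≡ isSColouring K s Γ f ∧ _≡ᵛ_ K (expVec K f) e
    allClassesFit≡isSColouring∧expVec {N} e f =
      trans (allᴸ-cong (allFins N) (λ i → cong (λ X → fits X (lookup e i)) (colourClass-just f i)))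
        (trans (allᴸ-∧ (λ i → facesMeetAtMost s Γ (class i)) (λ i → ∣ class i ∣ ≡ᵇ lookup e i) (allFins N))
               (cong₂ _∧_ sColouring sizes))
      where
      class : Fin N → Subset n
      class i = tabulate (λ v → does (lookup f v ≟ i))

      sColouring : allᴸ (λ i → facesMeetAtMost s Γ (class i)) (allFins N) ≡ isSColouring K s Γ f
      sColouring = sym (trans
        (allᴸ-cong (allSubsets n) (λ X →
          ∨-distribˡ-allᴸ (not (isFace Γ X)) (λ i → ∣ X ∩ class i ∣ ≤ᵇ s) (allFins N)))
        (allᴸ-comm (λ X i → not (isFace Γ X) ∨ (∣ X ∩ class i ∣ ≤ᵇ s)) (allSubsets n) (allFins N)))

      sizes : allᴸ (λ i → ∣ class i ∣ ≡ᵇ lookup e i) (allFins N) ≡ _≡ᵛ_ K (expVec K f) e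
      sizes = sym (trans (tabulate-≡ᵛ (λ i → ∣ fullˢ ∩ class i ∣) e)
        (allᴸ-cong (allFins N) (λ i → cong (λ X → ∣ X ∣ ≡ᵇ lookup e i) (∩-identityˡ (class i)))))

theorem4p2 : ∀ {c ℓ} (K : CommutativeRing c ℓ) → IsField K →
    (s : ℕ) → 1 ≤ s → ∀ {n} (Γ : SimplicialComplex n) (N : ℕ) (e : Vec ℕ N) →
    CommutativeRing._≈_ K (PsiZetaCoeff K s Γ e) (psiCoeff K s Γ e)
theorem4p2 K _ s _ {n} Γ N e =
  begin
    PsiZetaCoeff K s Γ e
  ≈⟨ PsiZetaCoeff≈zetaComp K s Γ e ⟩
    zetaComp K s Γ (toList e) fullˢ
  ≈⟨ zetaComp≈∑-colourings K s Γ e fullˢ ⟩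
    Σᴸ K (colourings fullˢ N) (λ f → [_]ᴷ K (allClassesFit f))
  ≈⟨ ∑-colourings-full K (λ f → [_]ᴷ K (allClassesFit f)) ⟩
    Σᴸ K (allMaps n N) (λ f → [_]ᴷ K (allClassesFit (Vec.map just f)))
  ≈⟨ ∑-cong K (allMaps n N) (λ f → reflexive (cong ([_]ᴷ K) (allClassesFit≡isSColouring∧expVec K s Γ e f))) ⟩
    psiCoeff K s Γ e
  ∎
  where
  open CommutativeRing K using (setoid; reflexive)
  open import Relation.Binary.Reasoning.Setoid setoid
  allClassesFit : PartialColouring n N → Bool
  allClassesFit f = allᴸ (λ i → fits K s Γ (colourClass f i) (lookup e i)) (allFins N)
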